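{- Let $X=(V,E)$ be a digraph that is not a disjoint union of paths. Then $$U_X=\sum_{\emptyset\ne S\subseteq E}(-1)^{|S|-1}U_{X\setminus S},$$ where $X\setminus S=(V,E\setminus S)$.
   Context: A digraph $X=(V,E)$ has a finite vertex set $V$, $|V|=n$, and $E\subseteq V\times V$ (loops allowed). $X$ is a disjoint union of paths if its vertex set is partitioned into sequences $(w_1,\dots,w_r)$, $r\ge1$, such that $E$ consists exactly of the edges $(w_i,w_{i+1})$ along these sequences. In particular, such an $X$ has no loops and no directed cycles. A $V$-listing is a bijection $\pi:[n]\to V$, and $X\mathrm{Des}(\pi)=\{i\in[n-1]:(\pi_i,\pi_{i+1})\in E\}$. Let $F_I=\sum_{i_1\le\dots\le i_n,\ i_j<i_{j+1}\ (j\in I)}x_{i_1}\cdots x_{i_n}$ for $I\subseteq[n-1]$. The Redei-Berge function is $U_X=\sum_\pi F_{X\mathrm{Des}(\pi)}$ over all $V$-listings. -}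

module Defs where

open import Data.Nat using (ℕ; zero; suc; _∸_; _<ᵇ_; _≡ᵇ_)
open import Data.Fin using (Fin; zero; suc; _≟_)
open import Data.Bool using (Bool; true; false; _∧_; _∨_; not; if_then_else_)
open import Data.List using (List; []; _∷_; [_]; _++_; map; concatMap; filterᵇ; allFin;
  cartesianProduct; length; zipWith; replicate; sum; concat)
open import Data.List.Relation.Unary.All using (All)
open import Data.List.Relation.Unary.Any using (Any)
open import Data.List.Relation.Unary.Unique.Propositional using (Unique)
open import Data.List.Membership.Propositional using (_∈_)
open import Data.Product using (_×_; _,_; Σ)
open import Data.Integer using (ℤ; +_; -1ℤ; _*_; _^_) renaming (_+_ to _+ℤ_)
open import Data.Bool.ListAction using (and; or)
open import Data.Vec.Functional using () renaming (_∷_ to _∷ᶠ_)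
open import Relation.Nullary using (does)
open import Relation.Binary.PropositionalEquality using (_≡_)
open import Function.Bundles using (_⇔_)

-- Digraphs on the vertex set V = Fin n (loops allowed): E u v = true iff (u,v) ∈ E.

Digraph : ℕ → Set
Digraph n = Fin n → Fin n → Bool

consecutive : {A : Set} → List A → List (A × A)
consecutive (x ∷ y ∷ r) = (x , y) ∷ consecutive (y ∷ r)
consecutive _ = []

-- X is a disjoint union of paths: the vertex set is partitioned into
-- nonempty sequences ws, and E consists exactly of the edges along them.
NonEmpty : {A : Set} → List A → Set
NonEmpty xs = Σ _ λ x → Σ _ λ r → xs ≡ x ∷ r

IsDisjointUnionOfPaths : (n : ℕ) → Digraph n → Set
IsDisjointUnionOfPaths n E =
  Σ (List (List (Fin n))) λ ws →
    All NonEmpty ws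
    × Unique (concat ws)
    × (∀ v → v ∈ concat ws)
    × (∀ u v → (E u v ≡ true) ⇔ Any (λ w → (u , v) ∈ consecutive w) ws)

allFuns : {A : Set} → List A → (m : ℕ) → List (Fin m → A)
allFuns xs zero = [ (λ ()) ]
allFuns xs (suc m) = concatMap (λ x → map (λ f → x ∷ᶠ f) (allFuns xs m)) xs

_≟ᵇ_ : {n : ℕ} → Fin n → Fin n → Bool
i ≟ᵇ j = does (i ≟ j)

isInjective : {n : ℕ} → (Fin n → Fin n) → Bool
isInjective {n} π =
  and (map (λ ij → let (i , j) = ij in (i ≟ᵇ j) ∨ not (π i ≟ᵇ π j))
           (cartesianProduct (allFin n) (allFin n)))

listings : (n : ℕ) → List (Fin n → Fin n)
listings n = filterᵇ isInjective (allFuns (allFin n) n)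

allDigraphs : (n : ℕ) → List (Digraph n)
allDigraphs n = allFuns (allFuns (true ∷ false ∷ []) n) n

allPairs : (n : ℕ) → List (Fin n × Fin n)
allPairs n = cartesianProduct (allFin n) (allFin n)

edgeCount : {n : ℕ} → Digraph n → ℕ
edgeCount {n} S = length (filterᵇ (λ p → let (u , v) = p in S u v) (allPairs n))

isSubsetOf : {n : ℕ} → Digraph n → Digraph n → Bool
isSubsetOf {n} S E = and (map (λ p → let (u , v) = p in not (S u v) ∨ E u v) (allPairs n))

isNonempty : {n : ℕ} → Digraph n → Bool
isNonempty {n} S = or (map (λ p → let (u , v) = p in S u v) (allPairs n))

nonemptyEdgeSubsets : {n : ℕ} → Digraph n → List (Digraph n)
nonemptyEdgeSubsets {n} E = filterᵇ (λ S → isSubsetOf S E ∧ isNonempty S) (allDigraphs n)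

_∖_ : {n : ℕ} → Digraph n → Digraph n → Digraph n
(E ∖ S) u v = E u v ∧ not (S u v)

-- Formal power series in x₁, x₂, … with ℤ coefficients, represented by
-- their coefficient function on monomials.  A monomial x₁^a₁ x₂^a₂ ⋯ x_k^a_k
-- is the exponent list (a₁ ∷ … ∷ a_k ∷ []) (trailing zeros are harmless).

Monomial : Set
Monomial = List ℕ

PowerSeries : Set
PowerSeries = Monomial → ℤ

indexSeq : ℕ → Monomial → List ℕ
indexSeq k [] = []
indexSeq k (a ∷ as) = replicate a k ++ indexSeq (suc k) as

-- fundamental quasisymmetric function F_I (degree n), with I ⊆ [n-1] given by
-- its characteristic list (I₁,…,I_{n-1}).  x^α appears (with coefficient 1)
-- iff its weakly increasing index sequence has length n and is strict at each j ∈ I.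
F : (n : ℕ) → List Bool → PowerSeries
F n I α =
  let s = indexSeq 1 α in
  if (length s ≡ᵇ n) ∧ and (zipWith (λ d p → let (a , b) = p in not d ∨ (a <ᵇ b)) I (consecutive s))
  then + 1 else + 0

XDes : {n : ℕ} → Digraph n → (Fin n → Fin n) → List Bool
XDes {n} E π = map (λ p → let (u , v) = p in E u v) (consecutive (map π (allFin n)))

sumℤ : List ℤ → ℤ
sumℤ [] = + 0
sumℤ (x ∷ xs) = x +ℤ sumℤ xs

U : (n : ℕ) → Digraph n → PowerSeries
U n E α = sumℤ (map (λ π → F n (XDes E π) α) (listings n))

{-# OPTIONS --safe #-}
module Submission where

-- Moving the right-hand side over, the claim is that Σ_{S ⊆ E} (-1)^|S| U_{X∖S} = 0, the term of
-- S = ∅ being U_X.  Expand every U_{X∖S} as Σ_π F_{XDes_{X∖S}(π)} and exchange the two sums.  For a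
-- fixed listing π some edge e ∈ E is not a consecutive pair (π_i, π_{i+1}): otherwise the maximal
-- E-runs of π would exhibit X as a disjoint union of paths.  Whether e ∈ S then does not affect
-- XDes_{X∖S}(π), so toggling e in S pairs off the terms of π with opposite signs.

open import Defs
open import Algebra.Properties.CommutativeSemigroup using (interchange)
open import Data.Bool using (Bool; true; false; _∧_; _∨_; not; if_then_else_)
import Data.Bool.Properties as Bool
open import Data.Bool.ListAction using (and; or)
open import Data.Fin using (Fin; zero; suc; punchIn; punchOut)
open import Data.Fin.Properties
  using (_≟_; any?; pigeonhole; punchOut-injective; punchIn-punchOut; <⇒≢)
open import Data.Integer using (ℤ; +_; -1ℤ; -_; _*_; _^_) renaming (_+_ to _+ℤ_)
import Data.Integer.Properties as ℤ
open import Data.List using (List; []; _∷_; _++_; map; concat; concatMap; filterᵇ; length; allFin)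
open import Data.List.Properties using (map-cong; map-cong-local; map-∘; map-++)
open import Data.List.Membership.Propositional using (_∈_; _∉_)
open import Data.List.Membership.Propositional.Properties using (∈-allFin; ∈-cartesianProduct⁺; ∈-map⁺)
import Data.List.Membership.DecPropositional as DecMembership
open import Data.List.Relation.Unary.All as All using (All; []; _∷_)
open import Data.List.Relation.Unary.All.Properties using (all⁺)
open import Data.List.Relation.Unary.AllPairs using ([]; _∷_)
open import Data.List.Relation.Unary.Any using (Any; here; there)
open import Data.List.Relation.Unary.Unique.Propositional using (Unique)
import Data.List.Relation.Unary.Unique.Propositional.Properties as Unique
open import Data.Nat using (ℕ; zero; suc; _∸_)
open import Data.Nat.Properties using (n<1+n)
open import Data.Product using (_×_; _,_; ∃; ∃₂; proj₁; proj₂)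
open import Data.Product.Properties using (≡-dec)
open import Data.Vec.Functional using (Vector; insertAt) renaming (_∷_ to _∷ᶠ_)
open import Data.Vec.Functional.Properties using (insertAt-lookup; insertAt-punchIn)
open import Data.Vec.Functional.Relation.Binary.Pointwise using (Pointwise)
open import Function.Base using (_∘_; _$_)
open import Function.Bundles using (mk⇔; module Equivalence)
open import Function.Definitions using (Injective)
open import Relation.Binary.Core using (_Preserves_⟶_)
open import Relation.Binary.PropositionalEquality
  using (_≡_; _≢_; refl; sym; trans; cong; cong₂; subst; module ≡-Reasoning)
open import Relation.Nullary using (¬_; Dec; yes; no; does; contradiction; _×-dec_)
open import Relation.Nullary.Decidable using (decidable-stable)

open ≡-Reasoning

variable
  A B : Set

cong₃ : {C D E F : Set} (f : C → D → E → F) {c c′ : C} {d d′ : D} {e e′ : E} →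
        c ≡ c′ → d ≡ d′ → e ≡ e′ → f c d e ≡ f c′ d′ e′
cong₃ f refl refl refl = refl

∑ : List A → (A → ℤ) → ℤ
∑ xs f = sumℤ (map f xs)

syntax ∑ xs (λ x → e) = ∑[ x ∈ xs ] e

sumℤ-++ : ∀ xs ys → sumℤ (xs ++ ys) ≡ sumℤ xs +ℤ sumℤ ys
sumℤ-++ []       ys = sym (ℤ.+-identityˡ _)
sumℤ-++ (x ∷ xs) ys = trans (cong (x +ℤ_) (sumℤ-++ xs ys)) (sym (ℤ.+-assoc x _ _))

∑-cong : {f g : A → ℤ} → (∀ x → f x ≡ g x) → ∀ xs → ∑ xs f ≡ ∑ xs g
∑-cong f≗g xs = cong sumℤ (map-cong f≗g xs)

∑-zero : {f : A → ℤ} → (∀ x → f x ≡ + 0) → ∀ xs → ∑ xs f ≡ + 0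
∑-zero f≗0 []       = refl
∑-zero f≗0 (x ∷ xs) = cong₂ _+ℤ_ (f≗0 x) (∑-zero f≗0 xs)

∑-+ : ∀ (f g : A → ℤ) xs → ∑[ x ∈ xs ] (f x +ℤ g x) ≡ ∑ xs f +ℤ ∑ xs g
∑-+ f g []       = refl
∑-+ f g (x ∷ xs) = trans (cong (f x +ℤ g x +ℤ_) (∑-+ f g xs))
                         (interchange ℤ.+-commutativeSemigroup (f x) (g x) _ _)

∑-swap : ∀ (f : A → B → ℤ) xs ys →
         ∑[ x ∈ xs ] ∑[ y ∈ ys ] f x y ≡ ∑[ y ∈ ys ] ∑[ x ∈ xs ] f x y
∑-swap f []       ys = sym (∑-zero (λ _ → refl) ys)
∑-swap f (x ∷ xs) ys = trans (cong (∑ ys (f x) +ℤ_) (∑-swap f xs ys)) (sym (∑-+ (f x) _ ys))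

*-distribˡ-∑ : ∀ c (f : A → ℤ) xs → c * ∑ xs f ≡ ∑[ x ∈ xs ] (c * f x)
*-distribˡ-∑ c f []       = ℤ.*-zeroʳ c
*-distribˡ-∑ c f (x ∷ xs) =
  trans (ℤ.*-distribˡ-+ c (f x) _) (cong (c * f x +ℤ_) (*-distribˡ-∑ c f xs))

∑-concatMap : ∀ (f : B → ℤ) (g : A → List B) xs →
              ∑ (concatMap g xs) f ≡ ∑[ x ∈ xs ] ∑ (g x) f
∑-concatMap f g []       = refl
∑-concatMap f g (x ∷ xs) = begin
  sumℤ (map f (g x ++ concatMap g xs))           ≡⟨ cong sumℤ (map-++ f (g x) _) ⟩
  sumℤ (map f (g x) ++ map f (concatMap g xs))   ≡⟨ sumℤ-++ (map f (g x)) _ ⟩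
  ∑ (g x) f +ℤ ∑ (concatMap g xs) f              ≡⟨ cong (∑ (g x) f +ℤ_) (∑-concatMap f g xs) ⟩
  ∑ (g x) f +ℤ ∑[ y ∈ xs ] ∑ (g y) f             ∎

∑-filterᵇ : ∀ (p : A → Bool) (f : A → ℤ) xs →
            ∑ (filterᵇ p xs) f ≡ ∑[ x ∈ xs ] (if p x then f x else + 0)
∑-filterᵇ p f []       = refl
∑-filterᵇ p f (x ∷ xs) with p x
... | true  = cong (f x +ℤ_) (∑-filterᵇ p f xs)
... | false = trans (∑-filterᵇ p f xs) (sym (ℤ.+-identityˡ _))

∑-filterᵇ-zero : ∀ (p : A → Bool) (f : A → ℤ) → (∀ x → p x ≡ true → f x ≡ + 0) →
                 ∀ xs → ∑ (filterᵇ p xs) f ≡ + 0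
∑-filterᵇ-zero p f f≗0 []       = refl
∑-filterᵇ-zero p f f≗0 (x ∷ xs) with p x in px
... | true  = cong₂ _+ℤ_ (f≗0 x px) (∑-filterᵇ-zero p f f≗0 xs)
... | false = ∑-filterᵇ-zero p f f≗0 xs

∑-allFuns-suc : ∀ (xs : List A) m (h : Vector A (suc m) → ℤ) →
                ∑ (allFuns xs (suc m)) h ≡ ∑[ x ∈ xs ] ∑[ g ∈ allFuns xs m ] h (x ∷ᶠ g)
∑-allFuns-suc xs m h =
  trans (∑-concatMap h _ xs) (∑-cong (λ _ → cong sumℤ (sym (map-∘ (allFuns xs m)))) xs)

insertAt⁺ : {R : A → A → Set} {m : ℕ} {xs ys : Vector A m} {x y : A} (k : Fin (suc m)) →
            Pointwise R xs ys → R x y → Pointwise R (insertAt xs k x) (insertAt ys k y)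
insertAt⁺                       zero    xs≈ys x≈y zero    = x≈y
insertAt⁺                       zero    xs≈ys x≈y (suc j) = xs≈ys j
insertAt⁺ {R = R} {m = suc m} (suc k) xs≈ys x≈y zero    = xs≈ys zero
insertAt⁺ {R = R} {m = suc m} (suc k) xs≈ys x≈y (suc j) = insertAt⁺ {R = R} k (xs≈ys ∘ suc) x≈y j

insertAt-minimal : ∀ {m} (xs : Vector A m) {k i : Fin (suc m)} (x y : A) → k ≢ i →
                   insertAt xs k x i ≡ insertAt xs k y i
insertAt-minimal xs {k} {i} x y k≢i = begin
  insertAt xs k x i                            ≡⟨ cong (insertAt xs k x) (sym (punchIn-punchOut k≢i)) ⟩
  insertAt xs k x (punchIn k (punchOut k≢i))   ≡⟨ insertAt-punchIn xs k x _ ⟩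
  xs (punchOut k≢i)                            ≡⟨ insertAt-punchIn xs k y _ ⟨
  insertAt xs k y (punchIn k (punchOut k≢i))   ≡⟨ cong (insertAt xs k y) (punchIn-punchOut k≢i) ⟩
  insertAt xs k y i                            ∎

-- Without function extensionality, summands over lists of functions have to respect pointwise
-- equality, so sums are taken up to a relation ≈.  SumPicks ≈ xs d says, in terms of sums, that d
-- occurs in xs exactly once up to ≈.
SumPicks : (A → A → Set) → List A → A → Set
SumPicks {A} _≈_ xs d =
  (h : A → ℤ) → h Preserves _≈_ ⟶ _≡_ → (∀ x → ¬ x ≈ d → h x ≡ + 0) → ∑ xs h ≡ h d

module _ (_≈_ : A → A → Set) (≈-refl : ∀ {x} → x ≈ x) where

  ∷-cong : ∀ {m} {x y : A} {g g′ : Vector A m} → x ≈ y → Pointwise _≈_ g g′ →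
           Pointwise _≈_ (x ∷ᶠ g) (y ∷ᶠ g′)
  ∷-cong x≈y g≈g′ zero    = x≈y
  ∷-cong x≈y g≈g′ (suc i) = g≈g′ i

  ∑-allFuns-insertAt : ∀ (xs : List A) {m} (h : Vector A (suc m) → ℤ) →
    h Preserves Pointwise _≈_ ⟶ _≡_ → (k : Fin (suc m)) →
    ∑ (allFuns xs (suc m)) h ≡ ∑[ g ∈ allFuns xs m ] ∑[ x ∈ xs ] h (insertAt g k x)
  ∑-allFuns-insertAt xs {m} h h-cong zero = begin
    ∑ (allFuns xs (suc m)) h
      ≡⟨ ∑-allFuns-suc xs m h ⟩
    ∑[ x ∈ xs ] ∑[ g ∈ allFuns xs m ] h (x ∷ᶠ g)
      ≡⟨ ∑-swap (λ x g → h (x ∷ᶠ g)) xs (allFuns xs m) ⟩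
    ∑[ g ∈ allFuns xs m ] ∑[ x ∈ xs ] h (x ∷ᶠ g)
      ≡⟨ ∑-cong (λ g → ∑-cong (λ x → h-cong (insertAt-zero g x)) xs) (allFuns xs m) ⟩
    ∑[ g ∈ allFuns xs m ] ∑[ x ∈ xs ] h (insertAt g zero x) ∎
    where
    insertAt-zero : ∀ g x → Pointwise _≈_ (x ∷ᶠ g) (insertAt g zero x)
    insertAt-zero g x zero    = ≈-refl
    insertAt-zero g x (suc j) = ≈-refl
  ∑-allFuns-insertAt xs {suc m} h h-cong (suc k) = begin
    ∑ (allFuns xs (suc (suc m))) h
      ≡⟨ ∑-allFuns-suc xs (suc m) h ⟩
    ∑[ y ∈ xs ] ∑[ g ∈ allFuns xs (suc m) ] h (y ∷ᶠ g)
      ≡⟨ ∑-cong (λ y → ∑-allFuns-insertAt xs _ (h-cong ∘ ∷-cong ≈-refl) k) xs ⟩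
    ∑[ y ∈ xs ] ∑[ g ∈ allFuns xs m ] ∑[ x ∈ xs ] h (y ∷ᶠ insertAt g k x)
      ≡⟨ ∑-cong (λ y → ∑-cong (λ g → ∑-cong (λ x → h-cong (insertAt-suc y g x)) xs)
                              (allFuns xs m)) xs ⟩
    ∑[ y ∈ xs ] ∑[ g ∈ allFuns xs m ] ∑[ x ∈ xs ] h (insertAt (y ∷ᶠ g) (suc k) x)
      ≡⟨ ∑-allFuns-suc xs m _ ⟨
    ∑[ g ∈ allFuns xs (suc m) ] ∑[ x ∈ xs ] h (insertAt g (suc k) x) ∎
    where
    insertAt-suc : ∀ y g x → Pointwise _≈_ (y ∷ᶠ insertAt g k x) (insertAt (y ∷ᶠ g) (suc k) x)
    insertAt-suc y g x zero    = ≈-refl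
    insertAt-suc y g x (suc j) = ≈-refl

  allFuns-sumPicks : ∀ {xs d} → SumPicks _≈_ xs d → ∀ m →
                     SumPicks (Pointwise _≈_) (allFuns xs m) (λ _ → d)
  allFuns-sumPicks xs-picks zero h h-cong h-vanishes = trans (ℤ.+-identityʳ _) (h-cong λ ())
  allFuns-sumPicks {xs} {d} xs-picks (suc m) h h-cong h-vanishes = begin
    ∑ (allFuns xs (suc m)) h
      ≡⟨ ∑-allFuns-suc xs m h ⟩
    ∑[ x ∈ xs ] ∑[ g ∈ allFuns xs m ] h (x ∷ᶠ g)
      ≡⟨ ∑-cong (λ x → allFuns-sumPicks xs-picks m _ (h-cong ∘ ∷-cong ≈-refl)
                         λ g g≉d → h-vanishes _ (g≉d ∘ (_∘ suc))) xs ⟩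
    ∑[ x ∈ xs ] h (x ∷ᶠ λ _ → d)
      ≡⟨ xs-picks _ (λ x≈y → h-cong (∷-cong x≈y λ _ → ≈-refl))
                    (λ x x≉d → h-vanishes _ (x≉d ∘ (_$ zero))) ⟩
    h (d ∷ᶠ λ _ → d)
      ≡⟨ h-cong (λ { zero → ≈-refl ; (suc _) → ≈-refl }) ⟩
    h (λ _ → d) ∎

bools : List Bool
bools = true ∷ false ∷ []

_≈ᴰ_ : ∀ {n} → Digraph n → Digraph n → Set
_≈ᴰ_ = Pointwise (Pointwise _≡_)

bools-sumPicks : SumPicks _≡_ bools false
bools-sumPicks h _ h-vanishes = begin
  h true +ℤ (h false +ℤ + 0)   ≡⟨ cong (_+ℤ (h false +ℤ + 0)) (h-vanishes true λ ()) ⟩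
  + 0 +ℤ (h false +ℤ + 0)      ≡⟨ trans (ℤ.+-identityˡ _) (ℤ.+-identityʳ _) ⟩
  h false                      ∎

allDigraphs-sumPicks : ∀ n → SumPicks _≈ᴰ_ (allDigraphs n) (λ _ _ → false)
allDigraphs-sumPicks n =
  allFuns-sumPicks (Pointwise _≡_) (λ _ → refl) (allFuns-sumPicks _≡_ refl bools-sumPicks n) n

AgreeOff : ∀ {n} → Fin n → Fin n → Digraph n → Digraph n → Set
AgreeOff u v S T = ∀ u′ v′ → (u′ , v′) ≢ (u , v) → S u′ v′ ≡ T u′ v′

-- Splitting off row u of S and then its entry v pairs up the digraphs with and without (u , v).
∑-allDigraphs-signReversing : ∀ {n} (h : Digraph n → ℤ) → h Preserves _≈ᴰ_ ⟶ _≡_ →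
  (u v : Fin n) → (∀ S T → AgreeOff u v S T → S u v ≡ true → T u v ≡ false → h S ≡ - h T) →
  ∑ (allDigraphs n) h ≡ + 0
∑-allDigraphs-signReversing {zero}  h h-cong () v h-flips
∑-allDigraphs-signReversing {suc m} h h-cong u  v h-flips = begin
  ∑ (allDigraphs (suc m)) h
    ≡⟨ ∑-allFuns-insertAt (Pointwise _≡_) (λ _ → refl) _ h h-cong u ⟩
  ∑[ G ∈ allFuns (allFuns bools (suc m)) m ] ∑[ row ∈ allFuns bools (suc m) ] h (insertAt G u row)
    ≡⟨ ∑-zero rows≡0 (allFuns (allFuns bools (suc m)) m) ⟩
  + 0 ∎
  where
  rows≡0 : ∀ G → ∑[ row ∈ allFuns bools (suc m) ] h (insertAt G u row) ≡ + 0
  rows≡0 G = trans (∑-allFuns-insertAt _≡_ refl bools (h ∘ insertAt G u)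
                      (λ r≈r′ → h-cong (insertAt⁺ {R = Pointwise _≡_} u (λ _ _ → refl) r≈r′)) v)
                   (∑-zero pair≡0 (allFuns bools m))
    where
    S : Vector Bool m → Bool → Digraph (suc m)
    S r b = insertAt G u (insertAt r v b)

    S-at : ∀ r b → S r b u v ≡ b
    S-at r b = trans (cong (_$ v) (insertAt-lookup G u _)) (insertAt-lookup r v b)

    S-agreeOff : ∀ r → AgreeOff u v (S r true) (S r false)
    S-agreeOff r u′ v′ ≢uv with u′ ≟ u
    ... | no u′≢u = cong (_$ v′) (insertAt-minimal G _ _ (u′≢u ∘ sym))
    ... | yes refl = begin
      S r true u v′          ≡⟨ cong (_$ v′) (insertAt-lookup G u _) ⟩
      insertAt r v true v′   ≡⟨ insertAt-minimal r true false (≢uv ∘ cong (u ,_) ∘ sym) ⟩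
      insertAt r v false v′  ≡⟨ cong (_$ v′) (insertAt-lookup G u _) ⟨
      S r false u v′         ∎

    pair≡0 : ∀ r → h (S r true) +ℤ (h (S r false) +ℤ + 0) ≡ + 0
    pair≡0 r = trans (cong₂ _+ℤ_ (h-flips _ _ (S-agreeOff r) (S-at r true) (S-at r false))
                                 (ℤ.+-identityʳ _))
                     (ℤ.+-inverseˡ (h (S r false)))

and-map-∈ : (p : A → Bool) (xs : List A) → and (map p xs) ≡ true → ∀ {x} → x ∈ xs → p x ≡ true
and-map-∈ p xs all-p x∈xs =
  Equivalence.to Bool.T-≡ (All.lookup (all⁺ p xs (Equivalence.from Bool.T-≡ all-p)) x∈xs)

or-map-∈ : (p : A → Bool) (xs : List A) → or (map p xs) ≡ false → ∀ {x} → x ∈ xs → p x ≡ false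
or-map-∈ p (y ∷ xs) none-p x∈xs with p y in py
or-map-∈ p (y ∷ xs) none-p (here refl)   | false = py
or-map-∈ p (y ∷ xs) none-p (there x∈xs) | false = or-map-∈ p xs none-p x∈xs

or-map⇒length-filterᵇ≡suc : (p : A → Bool) (xs : List A) → or (map p xs) ≡ true →
                            ∃ λ m → length (filterᵇ p xs) ≡ suc m
or-map⇒length-filterᵇ≡suc p (y ∷ xs) some-p with p y
... | true  = length (filterᵇ p xs) , refl
... | false = or-map⇒length-filterᵇ≡suc p xs some-p

and-map-true : (xs : List A) → and (map (λ _ → true) xs) ≡ true
and-map-true []       = refl
and-map-true (x ∷ xs) = and-map-true xs

or-map-false : (xs : List A) → or (map (λ _ → false) xs) ≡ false
or-map-false []       = refl
or-map-false (x ∷ xs) = or-map-false xs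

length-filterᵇ-false : (xs : List A) → length (filterᵇ (λ _ → false) xs) ≡ 0
length-filterᵇ-false []       = refl
length-filterᵇ-false (x ∷ xs) = length-filterᵇ-false xs

filterᵇ-cong-local : (p q : A → Bool) (xs : List A) → (∀ {x} → x ∈ xs → p x ≡ q x) →
                     filterᵇ p xs ≡ filterᵇ q xs
filterᵇ-cong-local p q []       p≗q = refl
filterᵇ-cong-local p q (x ∷ xs) p≗q with p x | q x | p≗q (here refl)
... | true  | true  | _ = cong (x ∷_) (filterᵇ-cong-local p q xs (p≗q ∘ there))
... | false | false | _ = filterᵇ-cong-local p q xs (p≗q ∘ there)

length-filterᵇ-toggle : (p q : A → Bool) {e : A} (xs : List A) → Unique xs → e ∈ xs →
  (∀ {x} → x ∈ xs → x ≢ e → p x ≡ q x) → p e ≡ true → q e ≡ false →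
  length (filterᵇ p xs) ≡ suc (length (filterᵇ q xs))
length-filterᵇ-toggle p q (x ∷ xs) (x∉xs ∷ _) (here refl) p≗q pe qe rewrite pe | qe =
  cong (suc ∘ length)
       (filterᵇ-cong-local p q xs λ y∈xs → p≗q (there y∈xs) (All.lookup x∉xs y∈xs ∘ sym))
length-filterᵇ-toggle p q (x ∷ xs) (e∉ ∷ unique) (there e∈xs) p≗q pe qe
  with p x | q x | p≗q (here refl) (All.lookup e∉ e∈xs)
... | true  | true  | _ = cong suc (length-filterᵇ-toggle p q xs unique e∈xs (p≗q ∘ there) pe qe)
... | false | false | _ = length-filterᵇ-toggle p q xs unique e∈xs (p≗q ∘ there) pe qe

module _ {n : ℕ} where

  ∈-allPairs : (u v : Fin n) → (u , v) ∈ allPairs n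
  ∈-allPairs u v = ∈-cartesianProduct⁺ (∈-allFin u) (∈-allFin v)

  allPairs-unique : Unique (allPairs n)
  allPairs-unique = Unique.cartesianProduct⁺ (Unique.allFin⁺ n) (Unique.allFin⁺ n)

  isSubsetOf-cong : (E : Digraph n) {S T : Digraph n} → S ≈ᴰ T → isSubsetOf S E ≡ isSubsetOf T E
  isSubsetOf-cong E S≈T =
    cong and (map-cong (λ (u , v) → cong (λ b → not b ∨ E u v) (S≈T u v)) (allPairs n))

  isNonempty-cong : {S T : Digraph n} → S ≈ᴰ T → isNonempty S ≡ isNonempty T
  isNonempty-cong S≈T = cong or (map-cong (λ (u , v) → S≈T u v) (allPairs n))

  edgeCount-cong : {S T : Digraph n} → S ≈ᴰ T → edgeCount S ≡ edgeCount T
  edgeCount-cong S≈T = cong length (filterᵇ-cong-local _ _ (allPairs n) λ {(u , v)} _ → S≈T u v)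

  ∖-cong : (E : Digraph n) {S T : Digraph n} → S ≈ᴰ T → (E ∖ S) ≈ᴰ (E ∖ T)
  ∖-cong E S≈T u v = cong (λ b → E u v ∧ not b) (S≈T u v)

  XDes-cong : {E E′ : Digraph n} → E ≈ᴰ E′ → ∀ π → XDes E π ≡ XDes E′ π
  XDes-cong E≈E′ π = map-cong (λ (u , v) → E≈E′ u v) (consecutive (map π (allFin n)))

  U-cong : {E E′ : Digraph n} → E ≈ᴰ E′ → ∀ α → U n E α ≡ U n E′ α
  U-cong E≈E′ α = ∑-cong (λ π → cong (λ I → F n I α) (XDes-cong E≈E′ π)) (listings n)

  isSubsetOf-agreeOff : (E : Digraph n) {u v : Fin n} {S T : Digraph n} →
                        E u v ≡ true → AgreeOff u v S T → isSubsetOf S E ≡ isSubsetOf T E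
  isSubsetOf-agreeOff E {u} {v} {S} {T} Euv S≡T = cong and (map-cong agree (allPairs n))
    where
    agree : ∀ ((u′ , v′) : Fin n × Fin n) →
            not (S u′ v′) ∨ E u′ v′ ≡ not (T u′ v′) ∨ E u′ v′
    agree (u′ , v′) with ≡-dec _≟_ _≟_ (u′ , v′) (u , v)
    ... | yes refl rewrite Euv = trans (Bool.∨-zeroʳ _) (sym (Bool.∨-zeroʳ _))
    ... | no ≢uv = cong (λ b → not b ∨ E u′ v′) (S≡T u′ v′ ≢uv)

  edgeCount-toggle : {u v : Fin n} {S T : Digraph n} →
                     AgreeOff u v S T → S u v ≡ true → T u v ≡ false → edgeCount S ≡ suc (edgeCount T)
  edgeCount-toggle {u} {v} S≡T Suv Tuv = length-filterᵇ-toggle _ _ (allPairs n) allPairs-unique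
    (∈-allPairs u v) (λ {(u′ , v′)} _ → S≡T u′ v′) Suv Tuv

  XDes-agreeOff : (E : Digraph n) (π : Fin n → Fin n) {u v : Fin n} {S T : Digraph n} →
                  (u , v) ∉ consecutive (map π (allFin n)) → AgreeOff u v S T →
                  XDes (E ∖ S) π ≡ XDes (E ∖ T) π
  XDes-agreeOff E π uv∉ S≡T = map-cong-local (All.tabulate λ {(u′ , v′)} uv′∈ →
    cong (λ b → E u′ v′ ∧ not b)
         (S≡T u′ v′ λ uv′≡uv → uv∉ (subst (_∈ _) uv′≡uv uv′∈)))

  isNonempty≡false⇒empty : {S : Digraph n} → isNonempty S ≡ false → S ≈ᴰ (λ _ _ → false)
  isNonempty≡false⇒empty none u v = or-map-∈ _ (allPairs n) none (∈-allPairs u v)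

  isNonempty≡true⇒edgeCount≡suc : {S : Digraph n} → isNonempty S ≡ true →
                                  ∃ λ m → edgeCount S ≡ suc m
  isNonempty≡true⇒edgeCount≡suc = or-map⇒length-filterᵇ≡suc _ (allPairs n)

module Runs {n : ℕ} (E : Digraph n) where

  glue : Bool → Fin n → List (Fin n) × List (List (Fin n)) → List (Fin n) × List (List (Fin n))
  glue true  y (w , ws) = y ∷ w , ws
  glue false y (w , ws) = [] , (y ∷ w) ∷ ws

  -- runsFrom x r = (w , ws): the maximal E-paths of x ∷ r are x ∷ w followed by ws.
  runsFrom : Fin n → List (Fin n) → List (Fin n) × List (List (Fin n))
  runsFrom x []      = [] , []
  runsFrom x (y ∷ r) = glue (E x y) y (runsFrom y r)

  runs : Fin n → List (Fin n) → List (List (Fin n))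
  runs x r = (x ∷ proj₁ (runsFrom x r)) ∷ proj₂ (runsFrom x r)

  runsFrom-concat : ∀ x r → proj₁ (runsFrom x r) ++ concat (proj₂ (runsFrom x r)) ≡ r
  runsFrom-concat x []      = refl
  runsFrom-concat x (y ∷ r) with E x y | runsFrom y r | runsFrom-concat y r
  ... | true  | w , ws | ih = cong (y ∷_) ih
  ... | false | w , ws | ih = cong (y ∷_) ih

  concat-runs : ∀ x r → concat (runs x r) ≡ x ∷ r
  concat-runs x r = cong (x ∷_) (runsFrom-concat x r)

  runsFrom-nonEmpty : ∀ x r → All NonEmpty (proj₂ (runsFrom x r))
  runsFrom-nonEmpty x []      = []
  runsFrom-nonEmpty x (y ∷ r) with E x y | runsFrom y r | runsFrom-nonEmpty y r
  ... | true  | w , ws | ih = ih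
  ... | false | w , ws | ih = (y , w , refl) ∷ ih

  runs-nonEmpty : ∀ x r → All NonEmpty (runs x r)
  runs-nonEmpty x r = (x , _ , refl) ∷ runsFrom-nonEmpty x r

  runs-sound : ∀ x r {u v} → Any (λ w → (u , v) ∈ consecutive w) (runs x r) → E u v ≡ true
  runs-sound x []      (here ())
  runs-sound x []      (there ())
  runs-sound x (y ∷ r) uv∈ with E x y in Exy | runsFrom y r | runs-sound y r
  ... | true | w , ws | ih with uv∈
  ...   | here (here refl)  = Exy
  ...   | here (there uv∈w) = ih (here uv∈w)
  ...   | there uv∈ws       = ih (there uv∈ws)
  runs-sound x (y ∷ r) uv∈ | false | w , ws | ih with uv∈
  ...   | there uv∈ws       = ih uv∈ws

  runs-complete : ∀ x r {u v} → (u , v) ∈ consecutive (x ∷ r) → E u v ≡ true →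
                  Any (λ w → (u , v) ∈ consecutive w) (runs x r)
  runs-complete x (y ∷ r) uv∈ Euv with E x y in Exy | runsFrom y r | runs-complete y r
  ... | true | w , ws | ih with uv∈
  ...   | here refl = here (here refl)
  ...   | there uv∈r with ih uv∈r Euv
  ...     | here uv∈w   = here (there uv∈w)
  ...     | there uv∈ws = there uv∈ws
  runs-complete x (y ∷ r) uv∈ Euv | false | w , ws | ih with uv∈
  ...   | here refl  = contradiction (trans (sym Euv) Exy) λ ()
  ...   | there uv∈r = there (ih uv∈r Euv)

listing⇒disjointUnionOfPaths : ∀ {n} (E : Digraph n) (l : List (Fin n)) → Unique l → (∀ v → v ∈ l) →
  (∀ u v → E u v ≡ true → (u , v) ∈ consecutive l) → IsDisjointUnionOfPaths n E
listing⇒disjointUnionOfPaths E [] unique covers complete =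
  [] , [] , unique , covers , λ u v → mk⇔ (λ Euv → contradiction (complete u v Euv) λ ()) λ ()
listing⇒disjointUnionOfPaths E (x ∷ r) unique covers complete =
  runs x r , runs-nonEmpty x r ,
  subst Unique (sym (concat-runs x r)) unique ,
  (λ v → subst (v ∈_) (sym (concat-runs x r)) (covers v)) ,
  λ u v → mk⇔ (λ Euv → runs-complete x r (complete u v Euv) Euv) (runs-sound x r)
  where open Runs E

isInjective⇒injective : ∀ {n} {π : Fin n → Fin n} → isInjective π ≡ true → Injective _≡_ _≡_ π
isInjective⇒injective {n} {π} injective {i} {j} πi≡πj =
  decide (i ≟ j) (π i ≟ π j) (and-map-∈ _ (allPairs n) injective (∈-allPairs i j))
  where
  decide : (i≟j : Dec (i ≡ j)) (πi≟πj : Dec (π i ≡ π j)) →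
           does i≟j ∨ not (does πi≟πj) ≡ true → i ≡ j
  decide (yes i≡j) _           _ = i≡j
  decide (no _)    (no πi≢πj) _ = contradiction πi≡πj πi≢πj

injective⇒surjective : ∀ {n} {π : Fin n → Fin n} → Injective _≡_ _≡_ π →
                       ∀ v → ∃ λ i → π i ≡ v
injective⇒surjective {suc n} {π} injective v with any? (λ i → π i ≟ v)
... | yes hit  = hit
... | no ¬hit with pigeonhole (n<1+n n)
                     (λ k → punchOut {i = v} {j = π k} λ v≡πk → ¬hit (k , sym v≡πk))
...   | i , j , i<j , πi≡πj =
  contradiction (injective (punchOut-injective {i = v} _ _ πi≡πj)) (<⇒≢ i<j)

missingEdge? : ∀ {n} (E : Digraph n) (l : List (Fin n)) →
               Dec (∃₂ λ u v → E u v ≡ true × (u , v) ∉ consecutive l)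
missingEdge? E l = any? λ u → any? λ v → (E u v Bool.≟ true) ×-dec ((u , v) ∉? consecutive l)
  where open DecMembership (≡-dec _≟_ _≟_) using (_∉?_)

listing-missesEdge : ∀ {n} (E : Digraph n) → ¬ IsDisjointUnionOfPaths n E →
  ∀ {π} → isInjective π ≡ true →
  ∃₂ λ u v → E u v ≡ true × (u , v) ∉ consecutive (map π (allFin n))
listing-missesEdge {n} E not-paths {π} π-injective with missingEdge? E (map π (allFin n))
... | yes missing = missing
... | no ¬missing = contradiction (listing⇒disjointUnionOfPaths E _ distinct covers complete) not-paths
  where
  open DecMembership (≡-dec _≟_ _≟_) using (_∈?_)

  distinct : Unique (map π (allFin n))
  distinct = Unique.map⁺ (isInjective⇒injective π-injective) (Unique.allFin⁺ n)

  covers : ∀ v → v ∈ map π (allFin n)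
  covers v with i , refl ← injective⇒surjective {π = π} (isInjective⇒injective π-injective) v =
    ∈-map⁺ π (∈-allFin i)

  complete : ∀ u v → E u v ≡ true → (u , v) ∈ consecutive (map π (allFin n))
  complete u v Euv = decidable-stable (_ ∈? _) λ uv∉ → ¬missing (u , v , Euv , uv∉)

signedIf : Bool → ℕ → ℤ → ℤ
signedIf s c x = if s then -1ℤ ^ c * x else + 0

signedIf-suc : ∀ s c x → signedIf s (suc c) x ≡ - signedIf s c x
signedIf-suc true  c x = trans (ℤ.*-assoc -1ℤ (-1ℤ ^ c) x) (ℤ.-1*i≡-i _)
signedIf-suc false c x = refl

signedIf-∑ : ∀ s c (f : A → ℤ) xs → signedIf s c (∑ xs f) ≡ ∑[ x ∈ xs ] signedIf s c (f x)
signedIf-∑ true  c f xs = *-distribˡ-∑ (-1ℤ ^ c) f xs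
signedIf-∑ false c f xs = sym (∑-zero (λ _ → refl) xs)

signedIf-cancel : ∀ s m x → signedIf s (suc m) x +ℤ signedIf (s ∧ true) m x ≡ + 0
signedIf-cancel true  m x =
  trans (cong (_+ℤ (-1ℤ ^ m * x)) (signedIf-suc true m x)) (ℤ.+-inverseˡ (-1ℤ ^ m * x))
signedIf-cancel false m x = refl

module Expansion {n : ℕ} (E : Digraph n) (α : Monomial) where

  signedTerm : Digraph n → ℤ
  signedTerm S = signedIf (isSubsetOf S E) (edgeCount S) (U n (E ∖ S) α)

  rhsTerm : Digraph n → ℤ
  rhsTerm S = signedIf (isSubsetOf S E ∧ isNonempty S) (edgeCount S ∸ 1) (U n (E ∖ S) α)

  signedTermAt : (Fin n → Fin n) → Digraph n → ℤ
  signedTermAt π S = signedIf (isSubsetOf S E) (edgeCount S) (F n (XDes (E ∖ S) π) α)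

  signedTerm-cong : signedTerm Preserves _≈ᴰ_ ⟶ _≡_
  signedTerm-cong S≈T =
    cong₃ signedIf (isSubsetOf-cong E S≈T) (edgeCount-cong S≈T) (U-cong (∖-cong E S≈T) α)

  rhsTerm-cong : rhsTerm Preserves _≈ᴰ_ ⟶ _≡_
  rhsTerm-cong S≈T = cong₃ signedIf (cong₂ _∧_ (isSubsetOf-cong E S≈T) (isNonempty-cong S≈T))
                                    (cong (_∸ 1) (edgeCount-cong S≈T)) (U-cong (∖-cong E S≈T) α)

  signedTermAt-cong : ∀ π → signedTermAt π Preserves _≈ᴰ_ ⟶ _≡_
  signedTermAt-cong π S≈T = cong₃ signedIf (isSubsetOf-cong E S≈T) (edgeCount-cong S≈T)
                                           (cong (λ I → F n I α) (XDes-cong (∖-cong E S≈T) π))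

  signedTermAt-flips : ∀ {π u v} → E u v ≡ true → (u , v) ∉ consecutive (map π (allFin n)) →
    ∀ S T → AgreeOff u v S T → S u v ≡ true → T u v ≡ false →
    signedTermAt π S ≡ - signedTermAt π T
  signedTermAt-flips {π} Euv uv∉ S T S≡T Suv Tuv = trans
    (cong₃ signedIf (isSubsetOf-agreeOff E Euv S≡T) (edgeCount-toggle S≡T Suv Tuv)
                    (cong (λ I → F n I α) (XDes-agreeOff E π uv∉ S≡T)))
    (signedIf-suc (isSubsetOf T E) (edgeCount T) (F n (XDes (E ∖ T) π) α))

  ∑-signedTerm≡0 : ¬ IsDisjointUnionOfPaths n E → ∑ (allDigraphs n) signedTerm ≡ + 0
  ∑-signedTerm≡0 not-paths = begin
    ∑ (allDigraphs n) signedTerm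
      ≡⟨ ∑-cong (λ S → signedIf-∑ (isSubsetOf S E) (edgeCount S) _ (listings n)) (allDigraphs n) ⟩
    ∑[ S ∈ allDigraphs n ] ∑[ π ∈ listings n ] signedTermAt π S
      ≡⟨ ∑-swap (λ S π → signedTermAt π S) (allDigraphs n) (listings n) ⟩
    ∑[ π ∈ listings n ] ∑ (allDigraphs n) (signedTermAt π)
      ≡⟨ ∑-filterᵇ-zero isInjective _ cancels (allFuns (allFin n) n) ⟩
    + 0 ∎
    where
    cancels : ∀ π → isInjective π ≡ true → ∑ (allDigraphs n) (signedTermAt π) ≡ + 0
    cancels π π-injective with u , v , Euv , uv∉ ← listing-missesEdge E not-paths π-injective =
      ∑-allDigraphs-signReversing (signedTermAt π) (signedTermAt-cong π) u v (signedTermAt-flips Euv uv∉)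

  -- The two terms of S cancel unless S = ∅.
  ∑-signedTerm+rhsTerm≡U : ∑[ S ∈ allDigraphs n ] (signedTerm S +ℤ rhsTerm S) ≡ U n E α
  ∑-signedTerm+rhsTerm≡U = begin
    ∑[ S ∈ allDigraphs n ] (signedTerm S +ℤ rhsTerm S)
      ≡⟨ allDigraphs-sumPicks n _
           (λ S≈T → cong₂ _+ℤ_ (signedTerm-cong S≈T) (rhsTerm-cong S≈T)) vanishes ⟩
    signedTerm ∅ +ℤ rhsTerm ∅
      ≡⟨ cong₃ (λ s ne c → signedIf s c x∅ +ℤ signedIf (s ∧ ne) (c ∸ 1) x∅)
               (and-map-true (allPairs n)) (or-map-false (allPairs n)) (length-filterᵇ-false (allPairs n)) ⟩
    -1ℤ ^ 0 * x∅ +ℤ + 0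
      ≡⟨ trans (ℤ.+-identityʳ _) (ℤ.*-identityˡ x∅) ⟩
    x∅
      ≡⟨ U-cong (λ u v → Bool.∧-identityʳ (E u v)) α ⟩
    U n E α ∎
    where
    ∅ : Digraph n
    ∅ _ _ = false

    x∅ : ℤ
    x∅ = U n (E ∖ ∅) α

    vanishes : ∀ S → ¬ S ≈ᴰ ∅ → signedTerm S +ℤ rhsTerm S ≡ + 0
    vanishes S S≉∅ with isNonempty S in nonempty
    ... | false = contradiction (isNonempty≡false⇒empty {S = S} nonempty) S≉∅
    ... | true with m , |S|≡1+m ← isNonempty≡true⇒edgeCount≡suc {S = S} nonempty =
      trans (cong (λ c → signedIf s c x +ℤ signedIf (s ∧ true) (c ∸ 1) x) |S|≡1+m)
            (signedIf-cancel s m x)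
      where
      s = isSubsetOf S E
      x = U n (E ∖ S) α

mainTheorem8 : (n : ℕ) (E : Digraph n) → ¬ IsDisjointUnionOfPaths n E →
    ∀ (α : Monomial) →
      U n E α ≡ sumℤ (map (λ S → (-1ℤ ^ (edgeCount S ∸ 1)) * U n (E ∖ S) α) (nonemptyEdgeSubsets E))
mainTheorem8 n E not-paths α = begin
  U n E α
    ≡⟨ ∑-signedTerm+rhsTerm≡U ⟨
  ∑[ S ∈ allDigraphs n ] (signedTerm S +ℤ rhsTerm S)
    ≡⟨ ∑-+ signedTerm rhsTerm (allDigraphs n) ⟩
  ∑ (allDigraphs n) signedTerm +ℤ ∑ (allDigraphs n) rhsTerm
    ≡⟨ cong (_+ℤ ∑ (allDigraphs n) rhsTerm) (∑-signedTerm≡0 not-paths) ⟩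
  + 0 +ℤ ∑ (allDigraphs n) rhsTerm
    ≡⟨ ℤ.+-identityˡ _ ⟩
  ∑ (allDigraphs n) rhsTerm
    ≡⟨ ∑-filterᵇ _ _ (allDigraphs n) ⟨
  sumℤ (map (λ S → (-1ℤ ^ (edgeCount S ∸ 1)) * U n (E ∖ S) α) (nonemptyEdgeSubsets E)) ∎
  where open Expansion E α
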